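{- Let $B(t,u,w)=\sum t^{\mathrm{hp}(\beta)}u^{\mathrm{wd}(\beta)}w^{h(\beta)}$, summed over all bar graphs $\beta$. Then $$B(t,u,w)=u\left(\frac{t^2w}{1-wt}+\frac{wt\,(B(t,u,1)-B(t,u,w))}{1-w}+\frac{B(t,u,w)\,t^2w}{1-wt}\right).$$
   Context: A bar graph is a polyomino consisting of $k\ge1$ consecutive columns of unit cells of heights $h_1,\dots,h_k\ge1$, all columns having their bottom on a common horizontal line (equivalently, a column-convex polyomino containing the bottom side of its bounding box); bar graphs are considered up to translation. For a bar graph $\beta$, $\mathrm{hp}(\beta)$ is half the length of its boundary (half-perimeter), $\mathrm{wd}(\beta)=k$ its width and $h(\beta)=h_k$ the height of its rightmost column. -}

module Defs where

open import Data.Nat using (ℕ; zero; suc; _∸_; ⌊_/2⌋; ∣_-_∣) renaming (_+_ to _+ℕ_; _*_ to _*ℕ_)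
open import Data.Integer using (ℤ; +_; _+_; _-_; _*_)
open import Data.List using (List; []; _∷_)
open import Data.List.NonEmpty using (List⁺; _∷_; head; last; length)

-- Bar graphs.
-- A bar graph with k ≥ 1 columns of heights h₁,…,h_k ≥ 1 is represented
-- (canonically, i.e. up to translation) by the non-empty list
-- (h₁ - 1, …, h_k - 1) of natural numbers.

BarGraph : Set
BarGraph = List⁺ ℕ

diffSum : ℕ → List ℕ → ℕ
diffSum x []       = 0
diffSum x (y ∷ ys) = ∣ x - y ∣ +ℕ diffSum y ys

-- length of the boundary:  2k (horizontal edges: bottom + top)
--   + h₁ + h_k + Σ |h_i - h_{i+1}|  (vertical edges)
perimeter : BarGraph → ℕ
perimeter (x ∷ xs) =
  2 *ℕ length (x ∷ xs) +ℕ suc x +ℕ suc (last (x ∷ xs)) +ℕ diffSum x xs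

hp : BarGraph → ℕ
hp β = ⌊ perimeter β /2⌋

wd : BarGraph → ℕ
wd β = length β

ht : BarGraph → ℕ
ht β = suc (last β)

-- Formal power series in t, u, w with integer coefficients:
-- S a b c is the coefficient of t^a u^b w^c.

PS : Set
PS = ℕ → ℕ → ℕ → ℤ

sumTo : ℕ → (ℕ → ℤ) → ℤ
sumTo zero    f = f 0
sumTo (suc n) f = sumTo n f + f (suc n)

_⊕_ : PS → PS → PS
(f ⊕ g) a b c = f a b c + g a b c

_⊖_ : PS → PS → PS
(f ⊖ g) a b c = f a b c - g a b c

_⊛_ : PS → PS → PS
(f ⊛ g) a b c =
  sumTo a λ i → sumTo b λ j → sumTo c λ l →
    f i j l * g (a ∸ i) (b ∸ j) (c ∸ l)

infixl 6 _⊕_ _⊖_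
infixl 7 _⊛_

one : PS
one zero zero zero = + 1
one _    _    _    = + 0

T : PS
T (suc zero) zero zero = + 1
T _          _    _    = + 0

U : PS
U zero (suc zero) zero = + 1
U _    _          _    = + 0

W : PS
W zero zero (suc zero) = + 1
W _    _    _          = + 0

pow : PS → ℕ → PS
pow f zero    = one
pow f (suc k) = f ⊛ pow f k

-- 1/(1 - f) = Σ_k f^k, for f with zero constant term (only the powers
-- k ≤ a+b+c contribute to the coefficient of t^a u^b w^c).
geom : PS → PS
geom f a b c = sumTo (a +ℕ b +ℕ c) λ k → pow f k a b c

-- substitution w := 1 for a series S in which the coefficient of
-- t^a u^b w^c vanishes for c > a (true for the bar graph series,
-- since h(β) ≤ hp(β)); the result is constant in w.
atW1 : PS → PS
atW1 f a b zero    = sumTo a λ c → f a b c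
atW1 f a b (suc _) = + 0

_≈PS_ : PS → PS → Set
f ≈PS g = ∀ a b c → f a b c ≡ g a b c
  where open import Relation.Binary.PropositionalEquality using (_≡_)

-- Remove the last column. A bar graph consisting of one column of height k ≥ 1 contributes
-- u t^(k+1) w^k, in total u t²w/(1 − tw). Any other bar graph arises from a bar graph whose last
-- column has height h by appending a column of height k; this multiplies u^wd by u and t^hp by
-- t^(1 + max(0, k − h)). Summing w^k over 1 ≤ k ≤ h replaces w^h by w(1 − w^h)/(1 − w), giving
-- u t w (B(t,u,1) − B(t,u,w))/(1 − w); summing t^(k − h) w^k over k > h replaces w^h by
-- t w^(h+1)/(1 − tw), giving u t²w B(t,u,w)/(1 − tw).

module Submission where

open import Defs
open import Data.Nat using (ℕ; zero; suc; _∸_; _≤_; _<_; z≤n; s≤s; ⌊_/2⌋; ∣_-_∣)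
  renaming (_+_ to _+ℕ_; _*_ to _*ℕ_)
import Data.Nat.Properties as ℕ
open import Data.List using (List; []; _∷_; foldl)
import Data.List as List
import Data.List.Properties as List
open import Data.List.NonEmpty as List⁺ using (List⁺; _∷_; _⁺∷ʳ_; _⁺++_; last; length)
open import Data.Integer using (ℤ; +_; _+_; _-_; _*_)
import Data.Integer.Properties as ℤ
import Data.Nat.Tactic.RingSolver as ℕ-Ring
import Data.Integer.Tactic.RingSolver as ℤ-Ring
open import Algebra.Properties.CommutativeSemigroup ℤ.+-commutativeSemigroup
  using () renaming (interchange to +-interchange)
open import Data.Product using (Σ; _×_; _,_)
open import Function using (_∘_)
open import Data.Sum using (_⊎_; inj₁; inj₂)
open import Data.Fin as Fin using (Fin)
open import Data.Fin.Properties using (+↔⊎)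
open import Data.Fin.Permutation using (↔⇒≡)
open import Function.Bundles using (_↔_; mk↔ₛ′; Inverse)
open import Function.Properties.Inverse using (↔-sym; ↔-trans)
open import Data.Sum.Function.Propositional using (_⊎-↔_)
open import Relation.Nullary using (¬_; yes; no; contradiction)
open import Relation.Binary.PropositionalEquality

-- Coefficient sequences

-- δ p n = [p = n], and delay p g n = [p ≤ n] g (n − p) is the coefficient sequence of t^p g(t).
δ : ℕ → ℕ → ℤ
δ zero    zero    = + 1
δ zero    (suc _) = + 0
δ (suc _) zero    = + 0
δ (suc p) (suc n) = δ p n

delay : ℕ → (ℕ → ℤ) → ℕ → ℤ
delay zero    g n       = g n
delay (suc p) g zero    = + 0
delay (suc p) g (suc n) = delay p g n

δ-sym : ∀ p n → δ p n ≡ δ n p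
δ-sym zero    zero    = refl
δ-sym zero    (suc n) = refl
δ-sym (suc p) zero    = refl
δ-sym (suc p) (suc n) = δ-sym p n

δ-refl : ∀ n → δ n n ≡ + 1
δ-refl zero    = refl
δ-refl (suc n) = δ-refl n

δ-≢ : ∀ {p n} → p ≢ n → δ p n ≡ + 0
δ-≢ {zero}  {zero}  p≢n = contradiction refl p≢n
δ-≢ {zero}  {suc n} _   = refl
δ-≢ {suc p} {zero}  _   = refl
δ-≢ {suc p} {suc n} p≢n = δ-≢ (p≢n ∘ cong suc)

delay-cong : ∀ p {g h : ℕ → ℤ} → (∀ n → g n ≡ h n) → ∀ n → delay p g n ≡ delay p h n
delay-cong zero    g≗h n       = g≗h n
delay-cong (suc p) g≗h zero    = refl
delay-cong (suc p) g≗h (suc n) = delay-cong p g≗h n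

delay-zero : ∀ p n → delay p (λ _ → + 0) n ≡ + 0
delay-zero zero    n       = refl
delay-zero (suc p) zero    = refl
delay-zero (suc p) (suc n) = delay-zero p n

delay-*ˡ : ∀ p x (g : ℕ → ℤ) n → delay p (λ m → x * g m) n ≡ x * delay p g n
delay-*ˡ zero    x g n       = refl
delay-*ˡ (suc p) x g zero    = sym (ℤ.*-zeroʳ x)
delay-*ˡ (suc p) x g (suc n) = delay-*ˡ p x g n

delay-*ʳ : ∀ p x (g : ℕ → ℤ) n → delay p (λ m → g m * x) n ≡ delay p g n * x
delay-*ʳ zero    x g n       = refl
delay-*ʳ (suc p) x g zero    = refl
delay-*ʳ (suc p) x g (suc n) = delay-*ʳ p x g n

delay-δ : ∀ p q n → delay p (δ q) n ≡ δ (p +ℕ q) n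
delay-δ zero    q n       = refl
delay-δ (suc p) q zero    = refl
delay-δ (suc p) q (suc n) = delay-δ p q n

delay-delay : ∀ p q (g : ℕ → ℤ) n → delay p (delay q g) n ≡ delay (p +ℕ q) g n
delay-delay zero    q g n       = refl
delay-delay (suc p) q g zero    = refl
delay-delay (suc p) q g (suc n) = delay-delay p q g n

delay-≡ : ∀ p {g : ℕ → ℤ} → g 0 ≡ + 0 → ∀ n → delay p g n ≡ g (n ∸ p)
delay-≡ zero    g0 n       = refl
delay-≡ (suc p) g0 zero    = sym g0
delay-≡ (suc p) g0 (suc n) = delay-≡ p g0 n

-- Finite sums

sumTo-cong : ∀ n {f g : ℕ → ℤ} → (∀ i → i ≤ n → f i ≡ g i) → sumTo n f ≡ sumTo n g
sumTo-cong zero    f≗g = f≗g 0 z≤n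
sumTo-cong (suc n) f≗g =
  cong₂ _+_ (sumTo-cong n (λ i i≤n → f≗g i (ℕ.m≤n⇒m≤1+n i≤n))) (f≗g (suc n) ℕ.≤-refl)

sumTo-zero : ∀ n {f : ℕ → ℤ} → (∀ i → i ≤ n → f i ≡ + 0) → sumTo n f ≡ + 0
sumTo-zero zero    f≗0 = f≗0 0 z≤n
sumTo-zero (suc n) f≗0 =
  cong₂ _+_ (sumTo-zero n (λ i i≤n → f≗0 i (ℕ.m≤n⇒m≤1+n i≤n))) (f≗0 (suc n) ℕ.≤-refl)

sumTo-*ˡ : ∀ n x (f : ℕ → ℤ) → sumTo n (λ i → x * f i) ≡ x * sumTo n f
sumTo-*ˡ zero    x f = refl
sumTo-*ˡ (suc n) x f =
  trans (cong (_+ x * f (suc n)) (sumTo-*ˡ n x f)) (sym (ℤ.*-distribˡ-+ x (sumTo n f) (f (suc n))))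

sumTo-*ʳ : ∀ n x (f : ℕ → ℤ) → sumTo n (λ i → f i * x) ≡ sumTo n f * x
sumTo-*ʳ zero    x f = refl
sumTo-*ʳ (suc n) x f =
  trans (cong (_+ f (suc n) * x) (sumTo-*ʳ n x f)) (sym (ℤ.*-distribʳ-+ x (sumTo n f) (f (suc n))))

sumTo-+ : ∀ n (f g : ℕ → ℤ) → sumTo n (λ i → f i + g i) ≡ sumTo n f + sumTo n g
sumTo-+ zero    f g = refl
sumTo-+ (suc n) f g =
  trans (cong (_+ (f (suc n) + g (suc n))) (sumTo-+ n f g))
        (+-interchange (sumTo n f) (sumTo n g) (f (suc n)) (g (suc n)))

sumTo-swap : ∀ m n (f : ℕ → ℕ → ℤ) →
  sumTo m (λ i → sumTo n (f i)) ≡ sumTo n (λ j → sumTo m (λ i → f i j))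
sumTo-swap zero    n f = refl
sumTo-swap (suc m) n f =
  trans (cong (_+ sumTo n (f (suc m))) (sumTo-swap m n f))
        (sym (sumTo-+ n (λ j → sumTo m (λ i → f i j)) (f (suc m))))

sumTo-front : ∀ n (f : ℕ → ℤ) → sumTo (suc n) f ≡ f 0 + sumTo n (f ∘ suc)
sumTo-front zero    f = refl
sumTo-front (suc n) f =
  trans (cong (_+ f (suc (suc n))) (sumTo-front n f)) (ℤ.+-assoc (f 0) _ _)

sumTo-reverse : ∀ n (f : ℕ → ℤ) → sumTo n f ≡ sumTo n (λ i → f (n ∸ i))
sumTo-reverse zero    f = refl
sumTo-reverse (suc n) f =
  trans (cong (_+ f (suc n)) (sumTo-reverse n f))
        (trans (ℤ.+-comm _ (f (suc n))) (sym (sumTo-front n (λ i → f (suc n ∸ i)))))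

sumTo-split : ∀ m n (f : ℕ → ℤ) →
  sumTo (suc m +ℕ n) f ≡ sumTo m f + sumTo n (λ i → f (suc m +ℕ i))
sumTo-split zero    n f = sumTo-front n f
sumTo-split (suc m) n f = begin
  sumTo (suc (suc m) +ℕ n) f                   ≡⟨ sumTo-front (suc m +ℕ n) f ⟩
  f 0 + sumTo (suc m +ℕ n) (f ∘ suc)            ≡⟨ cong (_+_ (f 0)) (sumTo-split m n (f ∘ suc)) ⟩
  f 0 + (sumTo m (f ∘ suc) + rest)              ≡⟨ ℤ.+-assoc (f 0) _ rest ⟨
  (f 0 + sumTo m (f ∘ suc)) + rest              ≡⟨ cong (_+ rest) (sumTo-front m f) ⟨
  sumTo (suc m) f + rest                        ∎
  where
  open ≡-Reasoning
  rest = sumTo n (λ i → f (suc (suc m) +ℕ i))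

sumTo-collapse : ∀ {p n} → p ≤ n → (g : ℕ → ℤ) → sumTo n (λ i → δ p i * g i) ≡ g p
sumTo-collapse {zero}  {zero}  _         g = ℤ.*-identityˡ (g 0)
sumTo-collapse {zero}  {suc n} _         g =
  trans (sumTo-front n _)
        (trans (cong₂ _+_ (ℤ.*-identityˡ (g 0)) (sumTo-zero n (λ _ _ → refl))) (ℤ.+-identityʳ (g 0)))
sumTo-collapse {suc p} {suc n} (s≤s p≤n) g =
  trans (sumTo-front n _) (trans (ℤ.+-identityˡ _) (sumTo-collapse p≤n (g ∘ suc)))

sumTo-δ-convolution : ∀ p n (g : ℕ → ℤ) → sumTo n (λ i → δ p i * g (n ∸ i)) ≡ delay p g n
sumTo-δ-convolution zero    zero    g = ℤ.*-identityˡ (g 0)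
sumTo-δ-convolution (suc p) zero    g = refl
sumTo-δ-convolution zero    (suc n) g =
  trans (sumTo-front n _)
        (trans (cong₂ _+_ (ℤ.*-identityˡ (g (suc n))) (sumTo-zero n (λ _ _ → refl)))
               (ℤ.+-identityʳ (g (suc n))))
sumTo-δ-convolution (suc p) (suc n) g =
  trans (sumTo-front n _) (trans (ℤ.+-identityˡ _) (sumTo-δ-convolution p n g))

sumTo-convolution-δ : ∀ p n (g : ℕ → ℤ) → sumTo n (λ i → g i * δ p (n ∸ i)) ≡ delay p g n
sumTo-convolution-δ p n g = begin
  sumTo n (λ i → g i * δ p (n ∸ i))                ≡⟨ sumTo-reverse n _ ⟩
  sumTo n (λ i → g (n ∸ i) * δ p (n ∸ (n ∸ i)))    ≡⟨ sumTo-cong n unreverse ⟩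
  sumTo n (λ i → δ p i * g (n ∸ i))                ≡⟨ sumTo-δ-convolution p n g ⟩
  delay p g n                                      ∎
  where
  open ≡-Reasoning
  unreverse : ∀ i → i ≤ n → g (n ∸ i) * δ p (n ∸ (n ∸ i)) ≡ δ p i * g (n ∸ i)
  unreverse i i≤n = trans (ℤ.*-comm (g (n ∸ i)) _) (cong (λ j → δ p j * g (n ∸ i)) (ℕ.m∸[m∸n]≡n i≤n))

sumTo-delay : ∀ p (g : ℕ → ℤ) n → sumTo n (delay p g) ≡ delay p (λ k → sumTo k g) n
sumTo-delay zero    g n       = refl
sumTo-delay (suc p) g zero    = refl
sumTo-delay (suc p) g (suc n) =
  trans (sumTo-front n (delay (suc p) g)) (trans (ℤ.+-identityˡ _) (sumTo-delay p g n))

sumTo-beyond : ∀ m n {f : ℕ → ℤ} → (∀ i → m < i → f i ≡ + 0) → sumTo (suc m +ℕ n) f ≡ sumTo m f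
sumTo-beyond m n {f} f≗0 =
  trans (sumTo-split m n f)
        (trans (cong (_+_ (sumTo m f)) (sumTo-zero n (λ i _ → f≗0 (suc m +ℕ i) (s≤s (ℕ.m≤m+n m i)))))
               (ℤ.+-identityʳ (sumTo m f)))

sumTo-agreeing-tails : ∀ k m {f g : ℕ → ℤ} →
  (∀ i → k < i → f i ≡ g i) → (∀ i → m < i → f i ≡ + 0) → (∀ i → m < i → g i ≡ + 0) →
  sumTo m f ≡ (sumTo m g - sumTo k g) + sumTo k f
sumTo-agreeing-tails k m {f} {g} f≗g f≗0 g≗0 = begin
  sumTo m f                               ≡⟨ split f f≗0 ⟩
  sumTo k f + tail f                      ≡⟨ cong (_+_ (sumTo k f)) tails-agree ⟩
  sumTo k f + tail g                      ≡⟨ rearrange (sumTo k f) (sumTo k g) (tail g) ⟩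
  ((sumTo k g + tail g) - sumTo k g) + sumTo k f ≡⟨ cong (λ s → (s - sumTo k g) + sumTo k f) (split g g≗0) ⟨
  (sumTo m g - sumTo k g) + sumTo k f     ∎
  where
  open ≡-Reasoning
  tail : (ℕ → ℤ) → ℤ
  tail h = sumTo m (λ i → h (suc k +ℕ i))
  split : ∀ h → (∀ i → m < i → h i ≡ + 0) → sumTo m h ≡ sumTo k h + tail h
  split h h≗0 = begin
    sumTo m h               ≡⟨ sumTo-beyond m k h≗0 ⟨
    sumTo (suc m +ℕ k) h    ≡⟨ cong (λ n → sumTo n h) (ℕ.+-comm (suc m) k) ⟩
    sumTo (k +ℕ suc m) h    ≡⟨ cong (λ n → sumTo n h) (ℕ.+-suc k m) ⟩
    sumTo (suc k +ℕ m) h    ≡⟨ sumTo-split k m h ⟩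
    sumTo k h + tail h      ∎
  rearrange : ∀ x y z → x + z ≡ ((y + z) - y) + x
  rearrange = ℤ-Ring.solve-∀
  tails-agree : tail f ≡ tail g
  tails-agree = sumTo-cong m (λ i _ → f≗g (suc k +ℕ i) (s≤s (ℕ.m≤m+n k i)))

-- Power series

monomial : ℕ → ℕ → ℕ → PS
monomial p q r a b c = δ p a * (δ q b * δ r c)

-- the coefficients of t^p u^q w^r F
shift : ℕ → ℕ → ℕ → PS → PS
shift p q r F a b c = delay p (λ a′ → delay q (λ b′ → delay r (F a′ b′) c) b) a

one≈monomial : one ≈PS monomial 0 0 0
one≈monomial zero    zero    zero    = refl
one≈monomial zero    zero    (suc c) = refl
one≈monomial zero    (suc b) c       = refl
one≈monomial (suc a) b       c       = refl

T≈monomial : T ≈PS monomial 1 0 0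
T≈monomial zero          b       c       = refl
T≈monomial (suc zero)    zero    zero    = refl
T≈monomial (suc zero)    zero    (suc c) = refl
T≈monomial (suc zero)    (suc b) c       = refl
T≈monomial (suc (suc a)) b       c       = refl

U≈monomial : U ≈PS monomial 0 1 0
U≈monomial zero    zero          c       = refl
U≈monomial zero    (suc zero)    zero    = refl
U≈monomial zero    (suc zero)    (suc c) = refl
U≈monomial zero    (suc (suc b)) c       = refl
U≈monomial (suc a) b             c       = refl

W≈monomial : W ≈PS monomial 0 0 1
W≈monomial zero    zero    zero          = refl
W≈monomial zero    zero    (suc zero)    = refl
W≈monomial zero    zero    (suc (suc c)) = refl
W≈monomial zero    (suc b) c             = refl
W≈monomial (suc a) b       c             = refl

⊛-cong : ∀ {F F′ G G′} → F ≈PS F′ → G ≈PS G′ → (F ⊛ G) ≈PS (F′ ⊛ G′)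
⊛-cong F≈F′ G≈G′ a b c =
  sumTo-cong a λ i _ → sumTo-cong b λ j _ → sumTo-cong c λ l _ →
    cong₂ _*_ (F≈F′ i j l) (G≈G′ (a ∸ i) (b ∸ j) (c ∸ l))

⊛-congˡ : ∀ {F F′} G → F ≈PS F′ → (F ⊛ G) ≈PS (F′ ⊛ G)
⊛-congˡ G F≈F′ = ⊛-cong {G = G} {G′ = G} F≈F′ λ _ _ _ → refl

⊛-congʳ : ∀ F {G G′} → G ≈PS G′ → (F ⊛ G) ≈PS (F ⊛ G′)
⊛-congʳ F = ⊛-cong {F} λ _ _ _ → refl

monomial-⊛ : ∀ p q r F → (monomial p q r ⊛ F) ≈PS shift p q r F
monomial-⊛ p q r F a b c = begin
  sumTo a (λ i → sumTo b (λ j → sumTo c (λ l →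
    (δ p i * (δ q j * δ r l)) * F (a ∸ i) (b ∸ j) (c ∸ l))))
    ≡⟨ sumTo-cong a (λ i _ → sumTo-cong b (λ j _ → collapse-w i j)) ⟩
  sumTo a (λ i → sumTo b (λ j → δ p i * (δ q j * delay r (F (a ∸ i) (b ∸ j)) c)))
    ≡⟨ sumTo-cong a (λ i _ → trans (sumTo-*ˡ b (δ p i) _) (cong (δ p i *_) (sumTo-δ-convolution q b _))) ⟩
  sumTo a (λ i → δ p i * delay q (λ b′ → delay r (F (a ∸ i) b′) c) b)
    ≡⟨ sumTo-δ-convolution p a _ ⟩
  shift p q r F a b c ∎
  where
  open ≡-Reasoning
  reassoc : ∀ x y z v → (x * (y * z)) * v ≡ x * (y * (z * v))
  reassoc = ℤ-Ring.solve-∀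
  collapse-w : ∀ i j → sumTo c (λ l → (δ p i * (δ q j * δ r l)) * F (a ∸ i) (b ∸ j) (c ∸ l))
                       ≡ δ p i * (δ q j * delay r (F (a ∸ i) (b ∸ j)) c)
  collapse-w i j = begin
    sumTo c (λ l → (δ p i * (δ q j * δ r l)) * F (a ∸ i) (b ∸ j) (c ∸ l))
      ≡⟨ sumTo-cong c (λ l _ → reassoc (δ p i) (δ q j) (δ r l) _) ⟩
    sumTo c (λ l → δ p i * (δ q j * (δ r l * F (a ∸ i) (b ∸ j) (c ∸ l))))
      ≡⟨ sumTo-*ˡ c (δ p i) _ ⟩
    δ p i * sumTo c (λ l → δ q j * (δ r l * F (a ∸ i) (b ∸ j) (c ∸ l)))
      ≡⟨ cong (δ p i *_) (trans (sumTo-*ˡ c (δ q j) _) (cong (δ q j *_) (sumTo-δ-convolution r c _))) ⟩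
    δ p i * (δ q j * delay r (F (a ∸ i) (b ∸ j)) c) ∎

⊛-monomial : ∀ p q r F → (F ⊛ monomial p q r) ≈PS shift p q r F
⊛-monomial p q r F a b c = begin
  sumTo a (λ i → sumTo b (λ j → sumTo c (λ l →
    F i j l * (δ p (a ∸ i) * (δ q (b ∸ j) * δ r (c ∸ l))))))
    ≡⟨ sumTo-cong a (λ i _ → sumTo-cong b (λ j _ → collapse-w i j)) ⟩
  sumTo a (λ i → sumTo b (λ j → (delay r (F i j) c * δ q (b ∸ j)) * δ p (a ∸ i)))
    ≡⟨ sumTo-cong a (λ i _ → trans (sumTo-*ʳ b (δ p (a ∸ i)) _)
                                   (cong (_* δ p (a ∸ i)) (sumTo-convolution-δ q b _))) ⟩
  sumTo a (λ i → delay q (λ b′ → delay r (F i b′) c) b * δ p (a ∸ i))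
    ≡⟨ sumTo-convolution-δ p a _ ⟩
  shift p q r F a b c ∎
  where
  open ≡-Reasoning
  reassoc : ∀ x y z v → v * (x * (y * z)) ≡ ((v * z) * y) * x
  reassoc = ℤ-Ring.solve-∀
  collapse-w : ∀ i j → sumTo c (λ l → F i j l * (δ p (a ∸ i) * (δ q (b ∸ j) * δ r (c ∸ l))))
                       ≡ (delay r (F i j) c * δ q (b ∸ j)) * δ p (a ∸ i)
  collapse-w i j = begin
    sumTo c (λ l → F i j l * (δ p (a ∸ i) * (δ q (b ∸ j) * δ r (c ∸ l))))
      ≡⟨ sumTo-cong c (λ l _ → reassoc (δ p (a ∸ i)) (δ q (b ∸ j)) (δ r (c ∸ l)) (F i j l)) ⟩
    sumTo c (λ l → ((F i j l * δ r (c ∸ l)) * δ q (b ∸ j)) * δ p (a ∸ i))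
      ≡⟨ sumTo-*ʳ c (δ p (a ∸ i)) _ ⟩
    sumTo c (λ l → (F i j l * δ r (c ∸ l)) * δ q (b ∸ j)) * δ p (a ∸ i)
      ≡⟨ cong (_* δ p (a ∸ i)) (trans (sumTo-*ʳ c (δ q (b ∸ j)) _)
                                      (cong (_* δ q (b ∸ j)) (sumTo-convolution-δ r c _))) ⟩
    (delay r (F i j) c * δ q (b ∸ j)) * δ p (a ∸ i) ∎

shift-monomial : ∀ p q r p′ q′ r′ →
  shift p q r (monomial p′ q′ r′) ≈PS monomial (p +ℕ p′) (q +ℕ q′) (r +ℕ r′)
shift-monomial p q r p′ q′ r′ a b c = begin
  delay p (λ a′ → delay q (λ b′ → delay r (λ c′ → δ p′ a′ * (δ q′ b′ * δ r′ c′)) c) b) a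
    ≡⟨ delay-cong p (λ a′ → delay-cong q (λ b′ → delay-w a′ b′) b) a ⟩
  delay p (λ a′ → delay q (λ b′ → δ p′ a′ * (δ q′ b′ * δ (r +ℕ r′) c)) b) a
    ≡⟨ delay-cong p delay-u a ⟩
  delay p (λ a′ → δ p′ a′ * (δ (q +ℕ q′) b * δ (r +ℕ r′) c)) a
    ≡⟨ trans (delay-*ʳ p _ (δ p′) a) (cong (_* (δ (q +ℕ q′) b * δ (r +ℕ r′) c)) (delay-δ p p′ a)) ⟩
  monomial (p +ℕ p′) (q +ℕ q′) (r +ℕ r′) a b c ∎
  where
  open ≡-Reasoning
  delay-w : ∀ a′ b′ →
    delay r (λ c′ → δ p′ a′ * (δ q′ b′ * δ r′ c′)) c ≡ δ p′ a′ * (δ q′ b′ * δ (r +ℕ r′) c)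
  delay-w a′ b′ = trans (delay-*ˡ r (δ p′ a′) _ c)
    (cong (δ p′ a′ *_) (trans (delay-*ˡ r (δ q′ b′) (δ r′) c) (cong (δ q′ b′ *_) (delay-δ r r′ c))))
  delay-u : ∀ a′ →
    delay q (λ b′ → δ p′ a′ * (δ q′ b′ * δ (r +ℕ r′) c)) b ≡ δ p′ a′ * (δ (q +ℕ q′) b * δ (r +ℕ r′) c)
  delay-u a′ = trans (delay-*ˡ q (δ p′ a′) _ b)
    (cong (δ p′ a′ *_) (trans (delay-*ʳ q _ (δ q′) b) (cong (_* δ (r +ℕ r′) c) (delay-δ q q′ b))))

monomial-⊛-monomial : ∀ p q r p′ q′ r′ →
  (monomial p q r ⊛ monomial p′ q′ r′) ≈PS monomial (p +ℕ p′) (q +ℕ q′) (r +ℕ r′)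
monomial-⊛-monomial p q r p′ q′ r′ a b c =
  trans (monomial-⊛ p q r _ a b c) (shift-monomial p q r p′ q′ r′ a b c)

W⊛T≈monomial : (W ⊛ T) ≈PS monomial 1 0 1
W⊛T≈monomial a b c =
  trans (⊛-cong W≈monomial T≈monomial a b c) (monomial-⊛-monomial 0 0 1 1 0 0 a b c)

pow-cong : ∀ {F G} → F ≈PS G → ∀ k → pow F k ≈PS pow G k
pow-cong F≈G zero    a b c = refl
pow-cong F≈G (suc k)       = ⊛-cong F≈G (pow-cong F≈G k)

geom-cong : ∀ {F G} → F ≈PS G → geom F ≈PS geom G
geom-cong F≈G a b c = sumTo-cong (a +ℕ b +ℕ c) (λ k _ → pow-cong F≈G k a b c)

pow-monomial : ∀ p k → pow (monomial p 0 1) k ≈PS monomial (k *ℕ p) 0 k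
pow-monomial p zero          = one≈monomial
pow-monomial p (suc k) a b c =
  trans (⊛-congʳ (monomial p 0 1) (pow-monomial p k) a b c)
        (monomial-⊛-monomial p 0 1 (k *ℕ p) 0 k a b c)

geom-monomial : ∀ p → geom (monomial p 0 1) ≈PS λ a b c → δ (c *ℕ p) a * δ 0 b
geom-monomial p a b c = begin
  sumTo (a +ℕ b +ℕ c) (λ k → pow (monomial p 0 1) k a b c)
    ≡⟨ sumTo-cong (a +ℕ b +ℕ c) (λ k _ → trans (pow-monomial p k a b c) (rearrange k)) ⟩
  sumTo (a +ℕ b +ℕ c) (λ k → δ c k * (δ (k *ℕ p) a * δ 0 b))
    ≡⟨ sumTo-collapse (ℕ.m≤n+m c (a +ℕ b)) (λ k → δ (k *ℕ p) a * δ 0 b) ⟩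
  δ (c *ℕ p) a * δ 0 b ∎
  where
  open ≡-Reasoning
  rotate : ∀ x y z → x * (y * z) ≡ z * (x * y)
  rotate = ℤ-Ring.solve-∀
  rearrange : ∀ k → δ (k *ℕ p) a * (δ 0 b * δ k c) ≡ δ c k * (δ (k *ℕ p) a * δ 0 b)
  rearrange k = trans (rotate (δ (k *ℕ p) a) (δ 0 b) (δ k c)) (cong (_* (δ (k *ℕ p) a * δ 0 b)) (δ-sym k c))

⊛-geom-monomial : ∀ p F a b c →
  (F ⊛ geom (monomial p 0 1)) a b c ≡ sumTo c (λ l → delay ((c ∸ l) *ℕ p) (λ x → F x b l) a)
⊛-geom-monomial p F a b c = begin
  (F ⊛ geom (monomial p 0 1)) a b c
    ≡⟨ ⊛-congʳ F (geom-monomial p) a b c ⟩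
  sumTo a (λ i → sumTo b (λ j → sumTo c (λ l → F i j l * (d i l * δ 0 (b ∸ j)))))
    ≡⟨ sumTo-cong a (λ i _ → sumTo-cong b (λ j _ →
         trans (sumTo-cong c (λ l _ → sym (ℤ.*-assoc (F i j l) _ _))) (sumTo-*ʳ c (δ 0 (b ∸ j)) _))) ⟩
  sumTo a (λ i → sumTo b (λ j → sumTo c (λ l → F i j l * d i l) * δ 0 (b ∸ j)))
    ≡⟨ sumTo-cong a (λ i _ → sumTo-convolution-δ 0 b (λ j → sumTo c (λ l → F i j l * d i l))) ⟩
  sumTo a (λ i → sumTo c (λ l → F i b l * d i l))
    ≡⟨ sumTo-swap a c (λ i l → F i b l * d i l) ⟩
  sumTo c (λ l → sumTo a (λ i → F i b l * d i l))
    ≡⟨ sumTo-cong c (λ l _ → sumTo-convolution-δ ((c ∸ l) *ℕ p) a (λ x → F x b l)) ⟩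
  sumTo c (λ l → delay ((c ∸ l) *ℕ p) (λ x → F x b l) a) ∎
  where
  open ≡-Reasoning
  d : ℕ → ℕ → ℤ
  d i l = δ ((c ∸ l) *ℕ p) (a ∸ i)

cumulative : PS → PS
cumulative F a b c = sumTo c (F a b)

⊛-geom-w : ∀ F → (F ⊛ geom W) ≈PS cumulative F
⊛-geom-w F a b c =
  trans (⊛-congʳ F (geom-cong W≈monomial) a b c)
        (trans (⊛-geom-monomial 0 F a b c)
               (sumTo-cong c (λ l _ → cong (λ r → delay r (λ x → F x b l) a) (ℕ.*-zeroʳ (c ∸ l)))))

⊛-geom-tw : ∀ F a b c → (F ⊛ geom (W ⊛ T)) a b c ≡ sumTo c (λ l → delay (c ∸ l) (λ x → F x b l) a)
⊛-geom-tw F a b c =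
  trans (⊛-congʳ F (geom-cong W⊛T≈monomial) a b c)
        (trans (⊛-geom-monomial 1 F a b c)
               (sumTo-cong c (λ l _ → cong (λ r → delay r (λ x → F x b l) a) (ℕ.*-identityʳ (c ∸ l)))))

diagonal : PS
diagonal a b c = δ c a * δ 0 b

geom-tw≈diagonal : geom (W ⊛ T) ≈PS diagonal
geom-tw≈diagonal a b c =
  trans (geom-cong W⊛T≈monomial a b c)
        (trans (geom-monomial 1 a b c) (cong (λ r → δ r a * δ 0 b) (ℕ.*-identityʳ c)))

U-⊛ : ∀ G → (U ⊛ G) ≈PS shift 0 1 0 G
U-⊛ G a b c = trans (⊛-congˡ G U≈monomial a b c) (monomial-⊛ 0 1 0 G a b c)

⊛-T : ∀ G → (G ⊛ T) ≈PS shift 1 0 0 G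
⊛-T G a b c = trans (⊛-congʳ G T≈monomial a b c) (⊛-monomial 1 0 0 G a b c)

⊛-W : ∀ G → (G ⊛ W) ≈PS shift 0 0 1 G
⊛-W G a b c = trans (⊛-congʳ G W≈monomial a b c) (⊛-monomial 0 0 1 G a b c)

T⊛T⊛W⊛geom-tw : (T ⊛ T ⊛ W ⊛ geom (W ⊛ T)) ≈PS shift 2 0 1 diagonal
T⊛T⊛W⊛geom-tw a b c =
  trans (⊛-cong T⊛T⊛W≈monomial geom-tw≈diagonal a b c) (monomial-⊛ 2 0 1 diagonal a b c)
  where
  T⊛T≈monomial : (T ⊛ T) ≈PS monomial 2 0 0
  T⊛T≈monomial a b c =
    trans (⊛-cong T≈monomial T≈monomial a b c) (monomial-⊛-monomial 1 0 0 1 0 0 a b c)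
  T⊛T⊛W≈monomial : (T ⊛ T ⊛ W) ≈PS monomial 2 0 1
  T⊛T⊛W≈monomial a b c =
    trans (⊛-cong T⊛T≈monomial W≈monomial a b c) (monomial-⊛-monomial 2 0 0 0 0 1 a b c)

W⊛T⊛G⊛geom-w : ∀ G → (W ⊛ T ⊛ G ⊛ geom W) ≈PS shift 1 0 1 (cumulative G)
W⊛T⊛G⊛geom-w G a b c = begin
  (W ⊛ T ⊛ G ⊛ geom W) a b c
    ≡⟨ ⊛-geom-w (W ⊛ T ⊛ G) a b c ⟩
  sumTo c ((W ⊛ T ⊛ G) a b)
    ≡⟨ sumTo-cong c (λ l _ → trans (⊛-congˡ G W⊛T≈monomial a b l) (monomial-⊛ 1 0 1 G a b l)) ⟩
  sumTo c (λ l → delay 1 (λ a′ → delay 1 (G a′ b) l) a)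
    ≡⟨ partial-sums a ⟩
  shift 1 0 1 (cumulative G) a b c ∎
  where
  open ≡-Reasoning
  partial-sums : ∀ a → sumTo c (λ l → delay 1 (λ a′ → delay 1 (G a′ b) l) a)
                       ≡ delay 1 (λ a′ → delay 1 (λ l → sumTo l (G a′ b)) c) a
  partial-sums zero    = sumTo-zero c (λ _ _ → refl)
  partial-sums (suc a) = sumTo-delay 1 (G a b) c

-- the coefficients of t²w F/(1 − tw)
higher : PS → PS
higher F a b c = delay 1 (λ k → sumTo k (λ h → delay (2 +ℕ (k ∸ h)) (λ x → F x b h) a)) c

G⊛T⊛T⊛W⊛geom-tw : ∀ G → (G ⊛ T ⊛ T ⊛ W ⊛ geom (W ⊛ T)) ≈PS higher G
G⊛T⊛T⊛W⊛geom-tw G a b c =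
  trans (⊛-geom-tw (G ⊛ T ⊛ T ⊛ W) a b c)
        (trans (sumTo-cong c (λ l _ → delay-cong (c ∸ l) (λ x → G⊛T⊛T⊛W x b l) a)) (collect c))
  where
  S : PS
  S a b c = delay 1 (λ l → delay 2 (λ x → G x b l) a) c
  G⊛T⊛T⊛W : (G ⊛ T ⊛ T ⊛ W) ≈PS S
  G⊛T⊛T⊛W a b c = begin
    (G ⊛ T ⊛ T ⊛ W) a b c
      ≡⟨ ⊛-W (G ⊛ T ⊛ T) a b c ⟩
    delay 1 ((G ⊛ T ⊛ T) a b) c
      ≡⟨ delay-cong 1 (λ l → trans (⊛-T (G ⊛ T) a b l) (delay-cong 1 (λ x → ⊛-T G x b l) a)) c ⟩
    delay 1 (λ l → delay 1 (delay 1 (λ x → G x b l)) a) c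
      ≡⟨ delay-cong 1 (λ l → delay-delay 1 1 (λ x → G x b l) a) c ⟩
    S a b c ∎
    where open ≡-Reasoning
  collect : ∀ c → sumTo c (λ l → delay (c ∸ l) (λ x → S x b l) a) ≡ higher G a b c
  collect zero    = refl
  collect (suc k) = begin
    sumTo (suc k) (λ l → delay (suc k ∸ l) (λ x → S x b l) a)
      ≡⟨ sumTo-front k _ ⟩
    delay (suc k) (λ _ → + 0) a + sumTo k (λ h → delay (k ∸ h) (delay 2 (λ x → G x b h)) a)
      ≡⟨ cong₂ _+_ (delay-zero (suc k) a)
                   (sumTo-cong k (λ h _ → trans (delay-delay (k ∸ h) 2 _ a)
                                                (cong (λ r → delay r (λ x → G x b h) a) (ℕ.+-comm (k ∸ h) 2)))) ⟩
    + 0 + higher G a b (suc k)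
      ≡⟨ ℤ.+-identityˡ _ ⟩
    higher G a b (suc k) ∎
    where open ≡-Reasoning

-- The summands count single columns, and bar graphs whose last column is not higher, resp.
-- higher, than the column before it.
attachColumn : PS → PS
attachColumn F = shift 2 0 1 diagonal ⊕ shift 1 0 1 (cumulative (atW1 F ⊖ F)) ⊕ higher F

recurrence-rhs : ∀ F → (U ⊛ ((T ⊛ T ⊛ W ⊛ geom (W ⊛ T))
                            ⊕ (W ⊛ T ⊛ (atW1 F ⊖ F) ⊛ geom W)
                            ⊕ (F ⊛ T ⊛ T ⊛ W ⊛ geom (W ⊛ T))))
                     ≈PS shift 0 1 0 (attachColumn F)
recurrence-rhs F a b c =
  trans (U-⊛ (P₁ ⊕ P₂ ⊕ P₃) a b c)
        (delay-cong 1 (λ m → cong₂ _+_ (cong₂ _+_ (T⊛T⊛W⊛geom-tw a m c)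
                                                  (W⊛T⊛G⊛geom-w (atW1 F ⊖ F) a m c))
                                        (G⊛T⊛T⊛W⊛geom-tw F a m c)) b)
  where
  P₁ P₂ P₃ : PS
  P₁ = T ⊛ T ⊛ W ⊛ geom (W ⊛ T)
  P₂ = W ⊛ T ⊛ (atW1 F ⊖ F) ⊛ geom W
  P₃ = F ⊛ T ⊛ T ⊛ W ⊛ geom (W ⊛ T)

attachColumn-t⁰ : ∀ F m c → attachColumn F 0 m c ≡ + 0
attachColumn-t⁰ F m zero    = refl
attachColumn-t⁰ F m (suc k) = trans (ℤ.+-identityˡ _) (sumTo-zero k (λ _ _ → refl))

attachColumn-w⁰ : ∀ F a m → attachColumn F a m 0 ≡ + 0
attachColumn-w⁰ F zero          m = refl
attachColumn-w⁰ F (suc zero)    m = refl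
attachColumn-w⁰ F (suc (suc a)) m = refl

sumTo-atW1⊖ : ∀ F a b k → sumTo k ((atW1 F ⊖ F) a b) ≡ sumTo a (F a b) - sumTo k (F a b)
sumTo-atW1⊖ F a b zero    = refl
sumTo-atW1⊖ F a b (suc k) =
  trans (cong (_+ (+ 0 - F a b (suc k))) (sumTo-atW1⊖ F a b k))
        (regroup (sumTo a (F a b)) (sumTo k (F a b)) (F a b (suc k)))
  where
  regroup : ∀ s t x → (s - t) + (+ 0 - x) ≡ s - (t + x)
  regroup = ℤ-Ring.solve-∀

-- Bar graphs

-- last is computed through snocView and does not reduce on xs ∷ʳ y; lastOf is a structural copy.
lastOf : BarGraph → ℕ
lastOf (x ∷ xs) = foldl (λ _ y → y) x xs

lastOf-∷ʳ : ∀ (xs : List ℕ) y → lastOf (xs List⁺.∷ʳ y) ≡ y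
lastOf-∷ʳ []       y = refl
lastOf-∷ʳ (x ∷ xs) y = List.foldl-∷ʳ (λ _ z → z) x y xs

last≡lastOf : ∀ β → last β ≡ lastOf β
last≡lastOf β with List⁺.snocView β
... | xs List⁺.∷ʳ′ y = sym (lastOf-∷ʳ xs y)

last-⁺∷ʳ : ∀ β y → last (β ⁺∷ʳ y) ≡ y
last-⁺∷ʳ β y = trans (last≡lastOf (β ⁺∷ʳ y)) (lastOf-∷ʳ (List⁺.toList β) y)

length-⁺∷ʳ : ∀ (β : BarGraph) y → length (β ⁺∷ʳ y) ≡ suc (length β)
length-⁺∷ʳ (x ∷ xs) y = cong suc (trans (List.length-++ xs) (ℕ.+-comm (List.length xs) 1))

diffSum-∷ʳ : ∀ x xs y → diffSum x (xs List.∷ʳ y) ≡ diffSum x xs +ℕ ∣ lastOf (x ∷ xs) - y ∣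
diffSum-∷ʳ x []       y = ℕ.+-identityʳ ∣ x - y ∣
diffSum-∷ʳ x (z ∷ zs) y =
  trans (cong (∣ x - z ∣ +ℕ_) (diffSum-∷ʳ z zs y)) (sym (ℕ.+-assoc ∣ x - z ∣ (diffSum z zs) _))

m+∣n-m∣≡m∸n+m∸n+n : ∀ m n → m +ℕ ∣ n - m ∣ ≡ (m ∸ n) +ℕ (m ∸ n) +ℕ n
m+∣n-m∣≡m∸n+m∸n+n m       zero    = sym (ℕ.+-identityʳ (m +ℕ m))
m+∣n-m∣≡m∸n+m∸n+n zero    (suc n) = refl
m+∣n-m∣≡m∸n+m∸n+n (suc m) (suc n) =
  trans (cong suc (m+∣n-m∣≡m∸n+m∸n+n m n)) (sym (ℕ.+-suc ((m ∸ n) +ℕ (m ∸ n)) n))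

-- Appending a column of height y + 1 adds 2 to the width part of the perimeter and
-- |l − y| to its vertical part, while the right side changes from l + 1 to y + 1.
perimeter-⁺∷ʳ : ∀ β y → perimeter (β ⁺∷ʳ y) ≡ 2 *ℕ suc (y ∸ last β) +ℕ perimeter β
perimeter-⁺∷ʳ (x ∷ xs) y = begin
  perimeter ((x ∷ xs) ⁺∷ʳ y)
    ≡⟨ cong₂ (λ w h → 2 *ℕ w +ℕ suc x +ℕ suc h +ℕ diffSum x (xs List.∷ʳ y))
             (length-⁺∷ʳ (x ∷ xs) y) (last-⁺∷ʳ (x ∷ xs) y) ⟩
  2 *ℕ suc L +ℕ suc x +ℕ suc y +ℕ diffSum x (xs List.∷ʳ y)
    ≡⟨ cong (2 *ℕ suc L +ℕ suc x +ℕ suc y +ℕ_) diffSum-snoc ⟩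
  2 *ℕ suc L +ℕ suc x +ℕ suc y +ℕ (D +ℕ ∣ l - y ∣)
    ≡⟨ separate L x y D ∣ l - y ∣ ⟩
  4 +ℕ 2 *ℕ L +ℕ x +ℕ D +ℕ (y +ℕ ∣ l - y ∣)
    ≡⟨ cong (4 +ℕ 2 *ℕ L +ℕ x +ℕ D +ℕ_) (m+∣n-m∣≡m∸n+m∸n+n y l) ⟩
  4 +ℕ 2 *ℕ L +ℕ x +ℕ D +ℕ ((y ∸ l) +ℕ (y ∸ l) +ℕ l)
    ≡⟨ regroup L x D (y ∸ l) l ⟩
  2 *ℕ suc (y ∸ l) +ℕ perimeter (x ∷ xs) ∎
  where
  open ≡-Reasoning
  L = suc (List.length xs)
  D = diffSum x xs
  l = last (x ∷ xs)
  diffSum-snoc : diffSum x (xs List.∷ʳ y) ≡ D +ℕ ∣ l - y ∣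
  diffSum-snoc = trans (diffSum-∷ʳ x xs y) (cong (λ l′ → D +ℕ ∣ l′ - y ∣) (sym (last≡lastOf (x ∷ xs))))
  separate : ∀ L x y D e →
    2 *ℕ suc L +ℕ suc x +ℕ suc y +ℕ (D +ℕ e) ≡ 4 +ℕ 2 *ℕ L +ℕ x +ℕ D +ℕ (y +ℕ e)
  separate = ℕ-Ring.solve-∀
  regroup : ∀ L x D g l →
    4 +ℕ 2 *ℕ L +ℕ x +ℕ D +ℕ (g +ℕ g +ℕ l) ≡ 2 *ℕ suc g +ℕ (2 *ℕ L +ℕ suc x +ℕ suc l +ℕ D)
  regroup = ℕ-Ring.solve-∀

-- Bar graphs built from the left by appending columns; as in BarGraph, entries are heights minus one.
data SnocBar : Set where
  column : ℕ → SnocBar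
  _▹_    : SnocBar → ℕ → SnocBar

top : SnocBar → ℕ
top (column h) = h
top (β ▹ h)    = h

height : SnocBar → ℕ
height β = suc (top β)

width : SnocBar → ℕ
width (column _) = 1
width (β ▹ _)    = suc (width β)

semiperimeter : SnocBar → ℕ
semiperimeter (column h) = 2 +ℕ h
semiperimeter (β ▹ h)    = suc (h ∸ top β) +ℕ semiperimeter β

toBarGraph : SnocBar → BarGraph
toBarGraph (column h) = h ∷ []
toBarGraph (β ▹ h)    = toBarGraph β ⁺∷ʳ h

fromBarGraph : BarGraph → SnocBar
fromBarGraph (h ∷ hs) = foldl _▹_ (column h) hs

toBarGraph-foldl : ∀ β hs → toBarGraph (foldl _▹_ β hs) ≡ toBarGraph β ⁺++ hs
toBarGraph-foldl β []       = sym (⁺++-[] (toBarGraph β))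
  where
  ⁺++-[] : ∀ (γ : BarGraph) → γ ⁺++ [] ≡ γ
  ⁺++-[] (x ∷ xs) = cong (x ∷_) (List.++-identityʳ xs)
toBarGraph-foldl β (h ∷ hs) = trans (toBarGraph-foldl (β ▹ h) hs) (⁺∷ʳ-⁺++ (toBarGraph β))
  where
  ⁺∷ʳ-⁺++ : ∀ (γ : BarGraph) → (γ ⁺∷ʳ h) ⁺++ hs ≡ γ ⁺++ (h ∷ hs)
  ⁺∷ʳ-⁺++ (x ∷ xs) = cong (x ∷_) (List.++-assoc xs (h ∷ []) hs)

toBarGraph-fromBarGraph : ∀ γ → toBarGraph (fromBarGraph γ) ≡ γ
toBarGraph-fromBarGraph (h ∷ hs) = toBarGraph-foldl (column h) hs

fromBarGraph-⁺∷ʳ : ∀ γ h → fromBarGraph (γ ⁺∷ʳ h) ≡ fromBarGraph γ ▹ h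
fromBarGraph-⁺∷ʳ (x ∷ xs) h = List.foldl-∷ʳ _▹_ (column x) h xs

fromBarGraph-toBarGraph : ∀ β → fromBarGraph (toBarGraph β) ≡ β
fromBarGraph-toBarGraph (column h) = refl
fromBarGraph-toBarGraph (β ▹ h)    =
  trans (fromBarGraph-⁺∷ʳ (toBarGraph β) h) (cong (_▹ h) (fromBarGraph-toBarGraph β))

wd-toBarGraph : ∀ β → wd (toBarGraph β) ≡ width β
wd-toBarGraph (column h) = refl
wd-toBarGraph (β ▹ h)    = trans (length-⁺∷ʳ (toBarGraph β) h) (cong suc (wd-toBarGraph β))

last-toBarGraph : ∀ β → last (toBarGraph β) ≡ top β
last-toBarGraph (column h) = refl
last-toBarGraph (β ▹ h)    = last-⁺∷ʳ (toBarGraph β) h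

ht-toBarGraph : ∀ β → ht (toBarGraph β) ≡ height β
ht-toBarGraph β = cong suc (last-toBarGraph β)

perimeter-toBarGraph : ∀ β → perimeter (toBarGraph β) ≡ semiperimeter β +ℕ semiperimeter β
perimeter-toBarGraph (column h) = column-perimeter h
  where
  column-perimeter : ∀ h → 2 *ℕ 1 +ℕ suc h +ℕ suc h +ℕ 0 ≡ (2 +ℕ h) +ℕ (2 +ℕ h)
  column-perimeter = ℕ-Ring.solve-∀
perimeter-toBarGraph (β ▹ h) = begin
  perimeter (toBarGraph β ⁺∷ʳ h)
    ≡⟨ perimeter-⁺∷ʳ (toBarGraph β) h ⟩
  2 *ℕ suc (h ∸ last (toBarGraph β)) +ℕ perimeter (toBarGraph β)
    ≡⟨ cong₂ (λ l p → 2 *ℕ suc (h ∸ l) +ℕ p) (last-toBarGraph β) (perimeter-toBarGraph β) ⟩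
  2 *ℕ suc (h ∸ top β) +ℕ (semiperimeter β +ℕ semiperimeter β)
    ≡⟨ double (suc (h ∸ top β)) (semiperimeter β) ⟩
  semiperimeter (β ▹ h) +ℕ semiperimeter (β ▹ h) ∎
  where
  open ≡-Reasoning
  double : ∀ d s → 2 *ℕ d +ℕ (s +ℕ s) ≡ (d +ℕ s) +ℕ (d +ℕ s)
  double = ℕ-Ring.solve-∀

hp-toBarGraph : ∀ β → hp (toBarGraph β) ≡ semiperimeter β
hp-toBarGraph β = trans (cong ⌊_/2⌋ (perimeter-toBarGraph β)) (sym (ℕ.n≡⌊n+n/2⌋ (semiperimeter β)))

height<semiperimeter : ∀ β → height β < semiperimeter β
height<semiperimeter (column h) = ℕ.≤-refl
height<semiperimeter (β ▹ h)    = s≤s (begin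
  suc h                             ≤⟨ s≤s (ℕ.m≤n+m∸n h (top β)) ⟩
  suc (top β +ℕ (h ∸ top β))        ≡⟨ cong suc (ℕ.+-comm (top β) (h ∸ top β)) ⟩
  suc ((h ∸ top β) +ℕ top β)        ≡⟨ ℕ.+-suc (h ∸ top β) (top β) ⟨
  (h ∸ top β) +ℕ height β           ≤⟨ ℕ.+-monoʳ-≤ (h ∸ top β) (ℕ.<⇒≤ (height<semiperimeter β)) ⟩
  (h ∸ top β) +ℕ semiperimeter β    ∎)
  where open ℕ.≤-Reasoning

Fibre : {X : Set} → (X → ℕ) → (X → ℕ) → (X → ℕ) → ℕ → ℕ → ℕ → Set
Fibre {X} s w h n m k = Σ X λ x → s x ≡ n × w x ≡ m × h x ≡ k

Fibre-≡ : ∀ {X : Set} {s w h : X → ℕ} {n m k} {x y : X} {p : s x ≡ n × w x ≡ m × h x ≡ k} {q} →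
  x ≡ y → _≡_ {A = Fibre s w h n m k} (x , p) (y , q)
Fibre-≡ {x = x} {p = p₁ , p₂ , p₃} {q₁ , q₂ , q₃} refl =
  cong (x ,_) (cong₂ _,_ (ℕ.≡-irrelevant p₁ q₁)
                         (cong₂ _,_ (ℕ.≡-irrelevant p₂ q₂) (ℕ.≡-irrelevant p₃ q₃)))

SnocBars : ℕ → ℕ → ℕ → Set
SnocBars = Fibre semiperimeter width height

BarGraphs↔SnocBars : ∀ n m k → Fibre hp wd ht n m k ↔ SnocBars n m k
BarGraphs↔SnocBars n m k = mk↔ₛ′ to from to∘from from∘to
  where
  transfer : ∀ {s : BarGraph → ℕ} {s′ : SnocBar → ℕ} → (∀ β → s (toBarGraph β) ≡ s′ β) →
             ∀ γ → s′ (fromBarGraph γ) ≡ s γ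
  transfer {s} s∘to≗s′ γ = trans (sym (s∘to≗s′ (fromBarGraph γ))) (cong s (toBarGraph-fromBarGraph γ))
  to : Fibre hp wd ht n m k → SnocBars n m k
  to (γ , p , q , r) = fromBarGraph γ , trans (transfer hp-toBarGraph γ) p ,
                       trans (transfer wd-toBarGraph γ) q , trans (transfer ht-toBarGraph γ) r
  from : SnocBars n m k → Fibre hp wd ht n m k
  from (β , p , q , r) = toBarGraph β , trans (hp-toBarGraph β) p ,
                         trans (wd-toBarGraph β) q , trans (ht-toBarGraph β) r
  to∘from : ∀ x → to (from x) ≡ x
  to∘from (β , _) = Fibre-≡ (fromBarGraph-toBarGraph β)
  from∘to : ∀ x → from (to x) ≡ x
  from∘to (γ , _) = Fibre-≡ (toBarGraph-fromBarGraph γ)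

-- The last column is removed; h is the height of the new last column.
appendColumn↔ : ∀ a m k →
  SnocBars (suc a) (2 +ℕ m) (suc k) ↔ Σ ℕ (λ h → h < suc a × SnocBars (a ∸ (suc k ∸ h)) (suc m) h)
appendColumn↔ a m k = mk↔ₛ′ to from to∘from from∘to
  where
  to : SnocBars (suc a) (2 +ℕ m) (suc k) → Σ ℕ (λ h → h < suc a × SnocBars (a ∸ (suc k ∸ h)) (suc m) h)
  to (column _ , _ , () , _)
  to (β ▹ k , p , q , refl) = height β , height<1+a , β , prefix-semiperimeter , ℕ.suc-injective q , refl
    where
    height<1+a : height β < suc a
    height<1+a = ℕ.<-≤-trans (height<semiperimeter β) (ℕ.≤-trans (ℕ.m≤n+m _ _) (ℕ.≤-reflexive p))
    prefix-semiperimeter : semiperimeter β ≡ a ∸ (k ∸ top β)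
    prefix-semiperimeter =
      trans (sym (ℕ.m+n∸m≡n (k ∸ top β) _)) (cong (_∸ (k ∸ top β)) (ℕ.suc-injective p))
  from : Σ ℕ (λ h → h < suc a × SnocBars (a ∸ (suc k ∸ h)) (suc m) h) → SnocBars (suc a) (2 +ℕ m) (suc k)
  from (_ , _ , β , p , q , refl) = β ▹ k , cong suc (∸-section (height<semiperimeter β) p) , cong suc q , refl
    where
    ∸-section : ∀ {d s h} → h < s → s ≡ a ∸ d → d +ℕ s ≡ a
    ∸-section {d} h<s refl = ℕ.m+[n∸m]≡n (ℕ.<⇒≤ (ℕ.m∸n≢0⇒n<m {a} {d} (ℕ.m<n⇒n≢0 h<s)))
  to∘from : ∀ x → to (from x) ≡ x
  to∘from (_ , h<1+a , β , _ , _ , refl) =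
    cong₂ (λ h<1+a′ x → height β , h<1+a′ , x) (ℕ.<-irrelevant _ h<1+a) (Fibre-≡ refl)
  from∘to : ∀ x → from (to x) ≡ x
  from∘to (column _ , _ , () , _)
  from∘to (β ▹ k , _ , _ , refl) = Fibre-≡ refl

-- Counting

sumBelow : ℕ → (ℕ → ℕ) → ℕ
sumBelow zero    f = 0
sumBelow (suc n) f = f 0 +ℕ sumBelow n (f ∘ suc)

Fin-sumBelow : ∀ n {Q : ℕ → Set} (f : ℕ → ℕ) → (∀ h → Fin (f h) ↔ Q h) →
  Fin (sumBelow n f) ↔ Σ ℕ (λ h → h < n × Q h)
Fin-sumBelow zero    f _   = mk↔ₛ′ (λ ()) (λ { (_ , () , _) }) (λ { (_ , () , _) }) (λ ())
Fin-sumBelow (suc n) {Q} f Fin↔Q =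
  ↔-trans +↔⊎ (↔-trans (Fin↔Q 0 ⊎-↔ Fin-sumBelow n (f ∘ suc) (Fin↔Q ∘ suc)) split-first)
  where
  split-first : (Q 0 ⊎ Σ ℕ (λ h → h < n × Q (suc h))) ↔ Σ ℕ (λ h → h < suc n × Q h)
  split-first = mk↔ₛ′ to from to∘from from∘to
    where
    to : Q 0 ⊎ Σ ℕ (λ h → h < n × Q (suc h)) → Σ ℕ (λ h → h < suc n × Q h)
    to (inj₁ q)             = 0 , s≤s z≤n , q
    to (inj₂ (h , h<n , q)) = suc h , s≤s h<n , q
    from : Σ ℕ (λ h → h < suc n × Q h) → Q 0 ⊎ Σ ℕ (λ h → h < n × Q (suc h))
    from (zero  , _         , q) = inj₁ q
    from (suc h , s≤s h<n , q) = inj₂ (h , h<n , q)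
    to∘from : ∀ x → to (from x) ≡ x
    to∘from (zero  , s≤s z≤n , q) = refl
    to∘from (suc h , s≤s h<n , q) = refl
    from∘to : ∀ x → from (to x) ≡ x
    from∘to (inj₁ _) = refl
    from∘to (inj₂ _) = refl

+-sumBelow : ∀ n f → + sumBelow (suc n) f ≡ sumTo n (λ h → + f h)
+-sumBelow zero    f = cong +_ (ℕ.+-identityʳ (f 0))
+-sumBelow (suc n) f =
  trans (ℤ.pos-+ (f 0) (sumBelow (suc n) (f ∘ suc)))
        (trans (cong (_+_ (+ f 0)) (+-sumBelow n (f ∘ suc))) (sym (sumTo-front n (λ h → + f h))))

Fin-empty : ∀ {p} {X : Set} → Fin p ↔ X → ¬ X → p ≡ 0
Fin-empty {zero}  _   _  = refl
Fin-empty {suc p} p↔X ¬x = contradiction (Inverse.to p↔X Fin.zero) ¬x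

module Counting (b : ℕ → ℕ → ℕ → ℕ) (b-counts : ∀ n m k → Fin (b n m k) ↔ Fibre hp wd ht n m k) where

  Fin-b : ∀ n m k → Fin (b n m k) ↔ SnocBars n m k
  Fin-b n m k = ↔-trans (b-counts n m k) (BarGraphs↔SnocBars n m k)

  b-width0 : ∀ n k → b n 0 k ≡ 0
  b-width0 n k = Fin-empty (Fin-b n 0 k) λ { (column _ , _ , () , _) ; (_ ▹ _ , _ , () , _) }

  b-height0 : ∀ n m → b n m 0 ≡ 0
  b-height0 n m = Fin-empty (Fin-b n m 0) λ { (_ , _ , _ , ()) }

  b-hp≤ht : ∀ {n k} m → n ≤ k → b n m k ≡ 0
  b-hp≤ht {n} {k} m n≤k = Fin-empty (Fin-b n m k) λ
    (β , p , _ , r) → ℕ.<⇒≱ (subst₂ _<_ r p (height<semiperimeter β)) n≤k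

  b-column : ∀ n k → + b n 1 (suc k) ≡ δ (2 +ℕ k) n
  b-column n k with n ℕ.≟ 2 +ℕ k
  ... | yes refl = trans (cong +_ (↔⇒≡ (↔-trans (Fin-b n 1 (suc k)) (↔-sym single))))
                         (sym (δ-refl (2 +ℕ k)))
    where
    single : Fin 1 ↔ SnocBars (2 +ℕ k) 1 (suc k)
    single = mk↔ₛ′ (λ _ → column k , refl , refl , refl) (λ _ → Fin.zero) unique
                   (λ { Fin.zero → refl ; (Fin.suc ()) })
      where
      unique : ∀ x → (column k , refl , refl , refl) ≡ x
      unique (column _ , _ , _ , refl) = Fibre-≡ refl
      unique (column _ ▹ _ , _ , () , _)
      unique ((_ ▹ _) ▹ _ , _ , () , _)
  ... | no n≢2+k = trans (cong +_ (Fin-empty (Fin-b n 1 (suc k)) no-bar)) (sym (δ-≢ (n≢2+k ∘ sym)))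
    where
    no-bar : ¬ SnocBars n 1 (suc k)
    no-bar (column _ , p , _ , refl) = n≢2+k (sym p)
    no-bar (column _ ▹ _ , _ , () , _)
    no-bar ((_ ▹ _) ▹ _ , _ , () , _)

  b-append : ∀ a m k → b (suc a) (2 +ℕ m) (suc k) ≡ sumBelow (suc a) (λ h → b (a ∸ (suc k ∸ h)) (suc m) h)
  b-append a m k = ↔⇒≡ (↔-trans (Fin-b (suc a) (2 +ℕ m) (suc k))
                        (↔-trans (appendColumn↔ a m k) (↔-sym (Fin-sumBelow (suc a) prefixes Fin-prefixes))))
    where
    prefixes : ℕ → ℕ
    prefixes h = b (a ∸ (suc k ∸ h)) (suc m) h
    Fin-prefixes : ∀ h → Fin (prefixes h) ↔ SnocBars (a ∸ (suc k ∸ h)) (suc m) h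
    Fin-prefixes h = Fin-b (a ∸ (suc k ∸ h)) (suc m) h

  b-last-column : ∀ a m k →
    + b (suc a) (suc m) (suc k) ≡ δ (suc k) a * δ 0 m + sumTo a (λ h → + b (a ∸ (suc k ∸ h)) m h)
  b-last-column a zero    k = begin
    + b (suc a) 1 (suc k)                                  ≡⟨ b-column (suc a) k ⟩
    δ (suc k) a                                            ≡⟨ ℤ.*-identityʳ (δ (suc k) a) ⟨
    δ (suc k) a * + 1                                      ≡⟨ ℤ.+-identityʳ _ ⟨
    δ (suc k) a * + 1 + + 0                                ≡⟨ cong (_+_ (δ (suc k) a * + 1)) no-width0 ⟨
    δ (suc k) a * + 1 + sumTo a (λ h → + b (a ∸ (suc k ∸ h)) 0 h) ∎
    where
    open ≡-Reasoning
    no-width0 : sumTo a (λ h → + b (a ∸ (suc k ∸ h)) 0 h) ≡ + 0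
    no-width0 = sumTo-zero a (λ h _ → cong +_ (b-width0 _ h))
  b-last-column a (suc m) k = begin
    + b (suc a) (2 +ℕ m) (suc k)                           ≡⟨ cong +_ (b-append a m k) ⟩
    + sumBelow (suc a) (λ h → b (a ∸ (suc k ∸ h)) (suc m) h) ≡⟨ +-sumBelow a _ ⟩
    S                                                      ≡⟨ ℤ.+-identityˡ S ⟨
    + 0 + S                                                ≡⟨ cong (_+ S) (ℤ.*-zeroʳ (δ (suc k) a)) ⟨
    δ (suc k) a * + 0 + S                                  ∎
    where
    open ≡-Reasoning
    S = sumTo a (λ h → + b (a ∸ (suc k ∸ h)) (suc m) h)

  B : PS
  B n m k = + b n m k

  B-recurrence : B ≈PS shift 0 1 0 (attachColumn B)
  B-recurrence a       zero    c       = cong +_ (b-width0 a c)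
  B-recurrence zero    (suc m) c       =
    trans (cong +_ (b-hp≤ht (suc m) z≤n)) (sym (attachColumn-t⁰ B m c))
  B-recurrence (suc a) (suc m) zero    =
    trans (cong +_ (b-height0 (suc a) (suc m))) (sym (attachColumn-w⁰ B (suc a) m))
  B-recurrence (suc a) (suc m) (suc k) = begin
    B (suc a) (suc m) (suc k)
      ≡⟨ b-last-column a m k ⟩
    δ (suc k) a * δ 0 m + sumTo a E
      ≡⟨ cong (_+_ (δ (suc k) a * δ 0 m)) (sumTo-agreeing-tails k a E≡B E≡0 B≡0) ⟩
    δ (suc k) a * δ 0 m + ((sumTo a (B a m) - sumTo k (B a m)) + sumTo k E)
      ≡⟨ ℤ.+-assoc (δ (suc k) a * δ 0 m) (sumTo a (B a m) - sumTo k (B a m)) (sumTo k E) ⟨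
    (δ (suc k) a * δ 0 m + (sumTo a (B a m) - sumTo k (B a m))) + sumTo k E
      ≡⟨ cong₂ _+_ (cong₂ _+_ (single-column a) (sym (sumTo-atW1⊖ B a m k))) (sym higher-terms) ⟩
    attachColumn B (suc a) m (suc k) ∎
    where
    open ≡-Reasoning
    E : ℕ → ℤ
    E h = B (a ∸ (suc k ∸ h)) m h
    E≡B : ∀ h → k < h → E h ≡ B a m h
    E≡B h k<h = cong (λ r → B (a ∸ r) m h) (ℕ.m≤n⇒m∸n≡0 k<h)
    E≡0 : ∀ h → a < h → E h ≡ + 0
    E≡0 h a<h = cong +_ (b-hp≤ht m (ℕ.≤-trans (ℕ.m∸n≤m a (suc k ∸ h)) (ℕ.<⇒≤ a<h)))
    B≡0 : ∀ h → a < h → B a m h ≡ + 0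
    B≡0 h a<h = cong +_ (b-hp≤ht m (ℕ.<⇒≤ a<h))
    single-column : ∀ a → δ (suc k) a * δ 0 m ≡ delay 1 (λ x → δ k x * δ 0 m) a
    single-column zero    = refl
    single-column (suc a) = refl
    -- delay may be traded for truncated subtraction since no bar graph has half-perimeter 0
    higher-terms : higher B (suc a) m (suc k) ≡ sumTo k E
    higher-terms = sumTo-cong k (λ h h≤k →
      trans (delay-≡ (suc (k ∸ h)) (cong +_ (b-hp≤ht m z≤n)) a)
            (cong (λ r → B (a ∸ r) m h) (sym (ℕ.+-∸-assoc 1 h≤k))))

lemma2p1 : (b : ℕ → ℕ → ℕ → ℕ) →
    (∀ n m k → Fin (b n m k) ↔ Σ BarGraph (λ β → hp β ≡ n × wd β ≡ m × ht β ≡ k)) →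
    let B : PS
        B = λ n m k → + (b n m k)
    in B ≈PS (U ⊛ ((T ⊛ T ⊛ W ⊛ geom (W ⊛ T))
                   ⊕ (W ⊛ T ⊛ (atW1 B ⊖ B) ⊛ geom W)
                   ⊕ (B ⊛ T ⊛ T ⊛ W ⊛ geom (W ⊛ T))))
lemma2p1 b b-counts a m c = trans (B-recurrence a m c) (sym (recurrence-rhs B a m c))
  where open Counting b b-counts
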